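{- Define $\mathcal{C}(t)\in G_{\mathtt{ALD}}$ for $t\in T$ inductively by $\mathcal{C}(x)=\mathrm{id}$, $\mathcal{C}(t_1*t_2)=\mathcal{C}(t_1)\bullet\mathrm{sh}_1(\mathcal{C}(t_2))\bullet\Sigma^+_\varepsilon\bullet\mathrm{sh}_1(\mathcal{C}(t_1))^{ -1}$, and $\mathcal{C}(t_1\circ t_2)=\mathcal{C}(t_1)\bullet\mathrm{sh}_1(\mathcal{C}(t_2))\bullet A^+_\varepsilon$. Then for every $t\in T$ there exists $p$ such that, for every sufficiently large $n$, the operator $\mathcal{C}(t)$ maps $x^{[n]}$ to $t*x^{[n-p]}$.
   Context: $T$ is the set of terms built from the single variable $x$ using binary operation symbols $*$ and $\circ$ (more generally terms may contain other variables). Addresses are words over $\{0,1\}$, $\varepsilon$ the root, $t/\alpha$ the subterm at $\alpha$. Right vines: $x^{[1]}=x$, $x^{[n]}=x*x^{[n-1]}$. Partial operators: $\Sigma^+_\alpha$ is defined on $t$ iff $t/\alpha=t_1*(t_2\,\square\,t_3)$ with $\square\in\{*,\circ\}$ and replaces this subterm by $(t_1*t_2)\,\square\,(t_1*t_3)$; $A^+_\alpha$ is defined iff $t/\alpha=t_1*(t_2*t_3)$ and replaces it by $(t_1\circ t_2)*t_3$; $\Sigma^-_\alpha,A^-_\alpha$ are their inverses. $G_{\mathtt{ALD}}$ is the monoid of partial operators generated by these under composition $f\bullet g$ = "first $f$, then $g$"; $f^{ -1}$ is the inverse partial map. For a partial operator $f$, $\mathrm{sh}_1(f)$ is the partial operator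 applying $f$ to the right subterm $t/1$ of its argument (defined iff $t/1$ exists and lies in the domain of $f$). -}

module Defs where

open import Data.Nat using (ℕ; zero; suc)
open import Data.List using (List; []; _∷_)
open import Data.Maybe using (Maybe; just; nothing; _>>=_)
open import Relation.Nullary using (yes; no)
open import Relation.Binary.PropositionalEquality using (_≡_; refl)

data OpSym : Set where
  star circ : OpSym

data Term : Set where
  x    : Term
  node : OpSym → Term → Term → Term

infixr 6 _*_ _∘_
_*_ : Term → Term → Term
t * u = node star t u

_∘_ : Term → Term → Term
t ∘ u = node circ t u

_≟ₒ_ : (a b : OpSym) → Data.Maybe.Maybe (a ≡ b)
star ≟ₒ star = just refl
circ ≟ₒ circ = just refl
_    ≟ₒ _    = nothing

_≟ₜ_ : (t u : Term) → Maybe (t ≡ u)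
x ≟ₜ x = just refl
node o t₁ t₂ ≟ₜ node o' u₁ u₂ with o ≟ₒ o' | t₁ ≟ₜ u₁ | t₂ ≟ₜ u₂
... | just refl | just refl | just refl = just refl
... | _ | _ | _ = nothing
_ ≟ₜ _ = nothing

-- right vines: vine n = x^[n] for n ≥ 1 (vine 0 = x is an unused convention)
vine : ℕ → Term
vine zero          = x
vine (suc zero)    = x
vine (suc (suc n)) = x * vine (suc n)

-- addresses: words over {0,1}, read from the root; 0 = left, 1 = right
data Bit : Set where
  b0 b1 : Bit

Address : Set
Address = List Bit

POp : Set
POp = Term → Maybe Term

at : Address → POp → POp
at []       f t               = f t
at (b0 ∷ α) f x               = nothing
at (b0 ∷ α) f (node o t₁ t₂)  = at α f t₁ Data.Maybe.>>= λ s → just (node o s t₂)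
at (b1 ∷ α) f x               = nothing
at (b1 ∷ α) f (node o t₁ t₂)  = at α f t₂ Data.Maybe.>>= λ s → just (node o t₁ s)

Σ⁺ε : POp
Σ⁺ε (node star t₁ (node o t₂ t₃)) = just (node o (t₁ * t₂) (t₁ * t₃))
Σ⁺ε _ = nothing

Σ⁻ε : POp
Σ⁻ε (node o (node star t₁ t₂) (node star t₁' t₃)) with t₁ ≟ₜ t₁'
... | just _  = just (t₁ * node o t₂ t₃)
... | nothing = nothing
Σ⁻ε _ = nothing

A⁺ε : POp
A⁺ε (node star t₁ (node star t₂ t₃)) = just ((t₁ ∘ t₂) * t₃)
A⁺ε _ = nothing

A⁻ε : POp
A⁻ε (node star (node circ t₁ t₂) t₃) = just (t₁ * (t₂ * t₃))
A⁻ε _ = nothing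

-- generators of G_ALD (positive ones; negative ones arise via inversion)
data Gen : Set where
  Σ⁺ A⁺ : Address → Gen

data GExpr : Set where
  idG  : GExpr
  gen  : Gen → GExpr
  _•_  : GExpr → GExpr → GExpr   -- f • g : first f, then g
  inv  : GExpr → GExpr
  sh₁  : GExpr → GExpr

infixl 5 _•_

_then_ : POp → POp → POp
(f then g) t = f t Data.Maybe.>>= g

mutual
  ⟦_⟧ : GExpr → POp
  ⟦ idG ⟧           = just
  ⟦ gen (Σ⁺ α) ⟧    = at α Σ⁺ε
  ⟦ gen (A⁺ α) ⟧    = at α A⁺ε
  ⟦ f • g ⟧         = ⟦ f ⟧ then ⟦ g ⟧
  ⟦ inv f ⟧         = ⟦ f ⟧⁻
  ⟦ sh₁ f ⟧         = at (b1 ∷ []) ⟦ f ⟧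

  ⟦_⟧⁻ : GExpr → POp
  ⟦ idG ⟧⁻          = just
  ⟦ gen (Σ⁺ α) ⟧⁻   = at α Σ⁻ε
  ⟦ gen (A⁺ α) ⟧⁻   = at α A⁻ε
  ⟦ f • g ⟧⁻        = ⟦ g ⟧⁻ then ⟦ f ⟧⁻
  ⟦ inv f ⟧⁻        = ⟦ f ⟧
  ⟦ sh₁ f ⟧⁻        = at (b1 ∷ []) ⟦ f ⟧⁻

C : Term → GExpr
C x                = idG
C (node star t₁ t₂) = C t₁ • sh₁ (C t₂) • gen (Σ⁺ []) • inv (sh₁ (C t₁))
C (node circ t₁ t₂) = C t₁ • sh₁ (C t₂) • gen (A⁺ [])

{-# OPTIONS --safe #-}
module Submission where

open import Defs
open import Data.Nat using (ℕ; zero; suc; _+_; _≤_; _∸_)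
open import Data.Nat.Properties using (+-assoc; +-comm; +-∸-assoc; m+n∸m≡n; m≤m+n; m≤n⇒∃[o]m+o≡n)
open import Data.Nat.Tactic.RingSolver using (solve-∀)
open import Data.Product using (∃-syntax; _,_)
open import Data.Maybe using (just; nothing)
open import Data.List using ([]; _∷_)
open import Relation.Binary.PropositionalEquality
open ≡-Reasoning

-- C(t) only inspects a bounded number of x's at the top of its argument: by
-- induction on t there are p ≥ q such that C(t) maps x * (x * ⋯ * (x * u)),
-- with p copies of x, to t * (x * ⋯ * (x * u)) with q copies, for every term u.
-- In the case t₁ * t₂ the final stage sh₁(C(t₁))⁻¹ is computed by recognising
-- its argument as the image under C(t₁) of a shorter such vine.
-- On a long enough vine x^[n] this gives the theorem with shift p - q.

vineOver : ℕ → Term → Term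
vineOver zero    u = u
vineOver (suc n) u = x * vineOver n u

vineOver-+ : ∀ m n u → vineOver (m + n) u ≡ vineOver m (vineOver n u)
vineOver-+ zero    n u = refl
vineOver-+ (suc m) n u = cong (x *_) (vineOver-+ m n u)

vineOver-comm : ∀ m n u → vineOver m (vineOver n u) ≡ vineOver n (vineOver m u)
vineOver-comm m n u = begin
  vineOver m (vineOver n u) ≡⟨ vineOver-+ m n u ⟨
  vineOver (m + n) u        ≡⟨ cong (λ k → vineOver k u) (+-comm m n) ⟩
  vineOver (n + m) u        ≡⟨ vineOver-+ n m u ⟩
  vineOver n (vineOver m u) ∎

vineOver-vine : ∀ m n → vineOver m (vine (suc n)) ≡ vine (suc (m + n))
vineOver-vine zero    n = refl
vineOver-vine (suc m) n = cong (x *_) (vineOver-vine m n)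

≟ₒ-refl : ∀ o → (o ≟ₒ o) ≡ just refl
≟ₒ-refl star = refl
≟ₒ-refl circ = refl

≟ₜ-refl : ∀ t → (t ≟ₜ t) ≡ just refl
≟ₜ-refl x            = refl
≟ₜ-refl (node o t u) rewrite ≟ₒ-refl o | ≟ₜ-refl t | ≟ₜ-refl u = refl

Undoes : POp → POp → Set
Undoes g f = ∀ a b → f a ≡ just b → g b ≡ just a

Σ⁻ε-undoes-Σ⁺ε : Undoes Σ⁻ε Σ⁺ε
Σ⁻ε-undoes-Σ⁺ε (node star t₁ (node o t₂ t₃)) _ refl rewrite ≟ₜ-refl t₁ = refl
Σ⁻ε-undoes-Σ⁺ε x                              _ ()
Σ⁻ε-undoes-Σ⁺ε (node star _ x)                _ ()
Σ⁻ε-undoes-Σ⁺ε (node circ _ _)                _ ()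

Σ⁺ε-undoes-Σ⁻ε : Undoes Σ⁺ε Σ⁻ε
Σ⁺ε-undoes-Σ⁻ε (node o (node star t₁ t₂) (node star t₁′ t₃)) _ _ with t₁ ≟ₜ t₁′
Σ⁺ε-undoes-Σ⁻ε (node o (node star t₁ t₂) (node star .t₁ t₃)) _ refl | just refl = refl
Σ⁺ε-undoes-Σ⁻ε (node o (node star _ _) (node star _ _))       _ ()   | nothing
Σ⁺ε-undoes-Σ⁻ε x                                              _ ()
Σ⁺ε-undoes-Σ⁻ε (node o x _)                                   _ ()
Σ⁺ε-undoes-Σ⁻ε (node o (node circ _ _) _)                     _ ()
Σ⁺ε-undoes-Σ⁻ε (node o (node star _ _) x)                     _ ()
Σ⁺ε-undoes-Σ⁻ε (node o (node star _ _) (node circ _ _))       _ ()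

A⁻ε-undoes-A⁺ε : Undoes A⁻ε A⁺ε
A⁻ε-undoes-A⁺ε (node star t₁ (node star t₂ t₃)) _ refl = refl
A⁻ε-undoes-A⁺ε x                                _ ()
A⁻ε-undoes-A⁺ε (node star _ x)                  _ ()
A⁻ε-undoes-A⁺ε (node star _ (node circ _ _))    _ ()
A⁻ε-undoes-A⁺ε (node circ _ _)                  _ ()

A⁺ε-undoes-A⁻ε : Undoes A⁺ε A⁻ε
A⁺ε-undoes-A⁻ε (node star (node circ t₁ t₂) t₃) _ refl = refl
A⁺ε-undoes-A⁻ε x                                _ ()
A⁺ε-undoes-A⁻ε (node star x _)                  _ ()
A⁺ε-undoes-A⁻ε (node star (node star _ _) _)    _ ()
A⁺ε-undoes-A⁻ε (node circ _ _)                  _ ()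

at-undoes : ∀ {g f} α → Undoes g f → Undoes (at α g) (at α f)
at-undoes [] u a b e = u a b e
at-undoes (b0 ∷ α) u x _ ()
at-undoes {f = f} (b0 ∷ α) u (node o t₁ t₂) b e with at α f t₁ in eq
... | just s with refl ← e rewrite at-undoes α u t₁ s eq = refl
at-undoes (b1 ∷ α) u x _ ()
at-undoes {f = f} (b1 ∷ α) u (node o t₁ t₂) b e with at α f t₂ in eq
... | just s with refl ← e rewrite at-undoes α u t₂ s eq = refl

then-undoes : ∀ {g f g′ f′} → Undoes g f → Undoes g′ f′ → Undoes (g′ then g) (f then f′)
then-undoes {f = f} u u′ a c e with f a in eq
... | just b rewrite u′ b c e = u a b eq

mutual
  ⟦⟧⁻-undoes-⟦⟧ : ∀ e → Undoes ⟦ e ⟧⁻ ⟦ e ⟧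
  ⟦⟧⁻-undoes-⟦⟧ idG           a _ refl = refl
  ⟦⟧⁻-undoes-⟦⟧ (gen (Σ⁺ α)) = at-undoes α Σ⁻ε-undoes-Σ⁺ε
  ⟦⟧⁻-undoes-⟦⟧ (gen (A⁺ α)) = at-undoes α A⁻ε-undoes-A⁺ε
  ⟦⟧⁻-undoes-⟦⟧ (f • g)      = then-undoes (⟦⟧⁻-undoes-⟦⟧ f) (⟦⟧⁻-undoes-⟦⟧ g)
  ⟦⟧⁻-undoes-⟦⟧ (inv f)      = ⟦⟧-undoes-⟦⟧⁻ f
  ⟦⟧⁻-undoes-⟦⟧ (sh₁ f)      = at-undoes (b1 ∷ []) (⟦⟧⁻-undoes-⟦⟧ f)

  ⟦⟧-undoes-⟦⟧⁻ : ∀ e → Undoes ⟦ e ⟧ ⟦ e ⟧⁻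
  ⟦⟧-undoes-⟦⟧⁻ idG           a _ refl = refl
  ⟦⟧-undoes-⟦⟧⁻ (gen (Σ⁺ α)) = at-undoes α Σ⁺ε-undoes-Σ⁻ε
  ⟦⟧-undoes-⟦⟧⁻ (gen (A⁺ α)) = at-undoes α A⁺ε-undoes-A⁻ε
  ⟦⟧-undoes-⟦⟧⁻ (f • g)      = then-undoes (⟦⟧-undoes-⟦⟧⁻ g) (⟦⟧-undoes-⟦⟧⁻ f)
  ⟦⟧-undoes-⟦⟧⁻ (inv f)      = ⟦⟧⁻-undoes-⟦⟧ f
  ⟦⟧-undoes-⟦⟧⁻ (sh₁ f)      = at-undoes (b1 ∷ []) (⟦⟧-undoes-⟦⟧⁻ f)

C-∘-maps : ∀ {t₁ t₂ a b c} →
           ⟦ C t₁ ⟧ a ≡ just (t₁ * b) → ⟦ C t₂ ⟧ b ≡ just (t₂ * c) →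
           ⟦ C (t₁ ∘ t₂) ⟧ a ≡ just ((t₁ ∘ t₂) * c)
C-∘-maps h₁ h₂ rewrite h₁ | h₂ = refl

C-*-maps : ∀ {t₁ t₂ a b c a′} →
           ⟦ C t₁ ⟧ a ≡ just (t₁ * b) → ⟦ C t₂ ⟧ b ≡ just (t₂ * c) →
           ⟦ C t₁ ⟧ a′ ≡ just (t₁ * c) →
           ⟦ C (t₁ * t₂) ⟧ a ≡ just ((t₁ * t₂) * a′)
C-*-maps {t₁} {a′ = a′} h₁ h₂ h₃
  rewrite h₁ | h₂ | ⟦⟧⁻-undoes-⟦⟧ (C t₁) a′ _ h₃ = refl

Consumes : Term → ℕ → ℕ → Set
Consumes t p q = ∀ u → ⟦ C t ⟧ (vineOver p u) ≡ just (t * vineOver q u)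

consumes-x : Consumes x 1 0
consumes-x u = refl

module _ {t₁ t₂ p₁ q₁ p₂ q₂} (c₁ : Consumes t₁ p₁ q₁) (c₂ : Consumes t₂ p₂ q₂) where

  private
    C-t₁-step : ∀ u → ⟦ C t₁ ⟧ (vineOver (p₁ + p₂) u) ≡ just (t₁ * vineOver p₂ (vineOver q₁ u))
    C-t₁-step u = begin
      ⟦ C t₁ ⟧ (vineOver (p₁ + p₂) u)        ≡⟨ cong ⟦ C t₁ ⟧ (vineOver-+ p₁ p₂ u) ⟩
      ⟦ C t₁ ⟧ (vineOver p₁ (vineOver p₂ u)) ≡⟨ c₁ (vineOver p₂ u) ⟩
      just (t₁ * vineOver q₁ (vineOver p₂ u)) ≡⟨ cong (λ v → just (t₁ * v)) (vineOver-comm q₁ p₂ u) ⟩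
      just (t₁ * vineOver p₂ (vineOver q₁ u)) ∎

  consumes-∘ : Consumes (t₁ ∘ t₂) (p₁ + p₂) (q₂ + q₁)
  consumes-∘ u = C-∘-maps (C-t₁-step u)
    (trans (c₂ (vineOver q₁ u)) (cong (λ v → just (t₂ * v)) (sym (vineOver-+ q₂ q₁ u))))

  consumes-* : Consumes (t₁ * t₂) (p₁ + p₂) (p₁ + q₂)
  consumes-* u rewrite vineOver-+ p₁ q₂ u = C-*-maps (C-t₁-step u) (c₂ (vineOver q₁ u))
    (trans (c₁ (vineOver q₂ u)) (cong (λ v → just (t₁ * v)) (vineOver-comm q₁ q₂ u)))

consumes : ∀ t → ∃[ d ] ∃[ q ] Consumes t (d + q) q
consumes x = 1 , 0 , consumes-x
consumes (node circ t₁ t₂) with consumes t₁ | consumes t₂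
... | d₁ , q₁ , c₁ | d₂ , q₂ , c₂ = d₁ + d₂ , q₂ + q₁ ,
  subst (λ p → Consumes (t₁ ∘ t₂) p (q₂ + q₁)) (shuffle d₁ d₂ q₁ q₂) (consumes-∘ c₁ c₂)
  where
  shuffle : ∀ d₁ d₂ q₁ q₂ → (d₁ + q₁) + (d₂ + q₂) ≡ (d₁ + d₂) + (q₂ + q₁)
  shuffle = solve-∀
consumes (node star t₁ t₂) with consumes t₁ | consumes t₂
... | d₁ , q₁ , c₁ | d₂ , q₂ , c₂ = d₂ , (d₁ + q₁) + q₂ ,
  subst (λ p → Consumes (t₁ * t₂) p ((d₁ + q₁) + q₂)) (shuffle (d₁ + q₁) d₂ q₂) (consumes-* c₁ c₂)
  where
  shuffle : ∀ p₁ d₂ q₂ → p₁ + (d₂ + q₂) ≡ d₂ + (p₁ + q₂)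
  shuffle = solve-∀

lemma3p4 : (t : Term) → ∃[ p ] ∃[ N ] ((n : ℕ) → N ≤ n →
    ⟦ C t ⟧ (vine n) ≡ just (t * vine (n ∸ p)))
lemma3p4 t with consumes t
... | d , q , c = d , suc (d + q) , maps
  where
  maps : ∀ n → suc (d + q) ≤ n → ⟦ C t ⟧ (vine n) ≡ just (t * vine (n ∸ d))
  maps n le with k , refl ← m≤n⇒∃[o]m+o≡n le = begin
    ⟦ C t ⟧ (vine (suc (d + q + k)))           ≡⟨ cong ⟦ C t ⟧ (vineOver-vine (d + q) k) ⟨
    ⟦ C t ⟧ (vineOver (d + q) (vine (suc k))) ≡⟨ c (vine (suc k)) ⟩
    just (t * vineOver q (vine (suc k)))       ≡⟨ cong (λ v → just (t * v)) (vineOver-vine q k) ⟩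
    just (t * vine (suc (q + k)))              ≡⟨ cong (λ m → just (t * vine m)) drop-d ⟨
    just (t * vine (suc (d + q + k) ∸ d))      ∎
    where
    drop-d : suc (d + q + k) ∸ d ≡ suc (q + k)
    drop-d = begin
      suc (d + q + k) ∸ d     ≡⟨ cong (λ m → suc m ∸ d) (+-assoc d q k) ⟩
      suc (d + (q + k)) ∸ d   ≡⟨ +-∸-assoc 1 (m≤m+n d (q + k)) ⟩
      suc (d + (q + k) ∸ d)   ≡⟨ cong suc (m+n∸m≡n d (q + k)) ⟩
      suc (q + k)             ∎
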